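{- Let $G$ be a dense $G_\delta$ subset of $2^\omega$ and $T$ the tree generated by a test. Then there are $\alpha_0\in G$ and a continuous map $f:2^\omega\to G$ such that for each $\alpha\in 2^\omega$: (a) $(\alpha_0,f(\alpha))\in[T]$; (b) for each $t\in\omega^{<\omega}$ and each $m\in\omega$: (i) if $\alpha(p(tm))=1$ then there is $m'\in\omega$ with $(\alpha_0\,\Delta\,f(\alpha))(p(tm')+1)=1$; (ii) if $(\alpha_0\,\Delta\,f(\alpha))(p(tm)+1)=1$ then there is $m'\in\omega$ with $\alpha(p(tm'))=1$.
   Context: Let $\varphi:\omega\to\omega^2$ be the bijection with inverse $\langle n,p\rangle:=\varphi^{ -1}(n,p)=\left(\sum_{k\le n+p}k\right)+p$, and write $\varphi(q)=((q)_0,(q)_1)$. A set $E\subseteq\bigcup_{q\in\omega}2^q\times 2^q$ is a test if: (a) for every $q$ there is a unique $(s_q,t_q)\in E\cap(2^q\times 2^q)$; (b) for all $m,p\in\omega$ and $u\in 2^{<\omega}$ there is $v\in 2^{<\omega}$ with $(s_p0uv,t_p1uv)\in E$ and $(|t_p1uv|-1)_0=m$; (c) for every $n>0$ there are $q<n$ and $w$ with $s_n=s_q0w$, $t_n=t_q1w$. The tree generated by $E$ is $T:=\{(s,t): s=t=\emptyset\text{ or }\exists q\ \exists w\ (s,t)=(s_q0w,t_q1w)\}$, and $[T]:=\{(\alpha,\beta)\in 2^\omega\times 2^\omega:\forall r\ (\alpha|r,\beta|r)\in T\}$. The map $p:\omega^{<\omega}\setminus\{\emptyset\}\to\omega$ is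 defined by $p(s):=s(0)$ if $|s|=1$ and $p(s):=\langle p(s|(|s|-1)),s(|s|-1)\rangle$ otherwise; $tm$ denotes the sequence $t$ followed by $m$. $\alpha\,\Delta\,\beta\in 2^\omega$ is the symmetric difference: $(\alpha\,\Delta\,\beta)(k)=1$ iff $\alpha(k)\neq\beta(k)$. -}

module Defs where

open import Data.Nat using (ℕ; zero; suc; _+_; _∸_; _<_)
open import Data.Bool using (Bool; true; false; _xor_)
open import Data.List using (List; []; _∷_; _++_; length)
import Data.List as List
open import Data.List.NonEmpty using (List⁺; _∷_)
open import Data.Product using (Σ; ∃; _×_; _,_)
open import Data.Sum using (_⊎_)
open import Function.Bundles using (_⇔_)
open import Relation.Binary.PropositionalEquality using (_≡_)

Cantor : Set
Cantor = ℕ → Bool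

prefix : Cantor → ℕ → List Bool
prefix α zero    = []
prefix α (suc r) = α 0 ∷ prefix (λ k → α (suc k)) r

tri : ℕ → ℕ
tri zero    = 0
tri (suc n) = suc n + tri n

-- ⟨ n , p ⟩ = (Σ_{k ≤ n+p} k) + p   (inverse of the bijection φ)
⟨_,_⟩ : ℕ → ℕ → ℕ
⟨ n , p ⟩ = tri (n + p) + p

-- p(s) on nonempty finite sequences: p(s) = s(0) if |s| = 1,
-- p(s) = ⟨ p(s|(|s|-1)) , s(|s|-1) ⟩ otherwise
pcode : List⁺ ℕ → ℕ
pcode (x ∷ xs) = List.foldl ⟨_,_⟩ x xs

_Δ_ : Cantor → Cantor → Cantor
(α Δ β) k = α k xor β k

record IsTest (E : List Bool → List Bool → Set) : Set where
  field
    sameLength : ∀ s t → E s t → length s ≡ length t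
    unique : ∀ q → Σ (List Bool) λ s → Σ (List Bool) λ t →
               (length s ≡ q × E s t) ×
               (∀ s' t' → length s' ≡ q → E s' t' → (s' ≡ s × t' ≡ t))
    condB : ∀ m p (u : List Bool) sp tp → length sp ≡ p → E sp tp →
              Σ (List Bool) λ v →
                E (sp ++ false ∷ u ++ v) (tp ++ true ∷ u ++ v) ×
                -- (|t_p 1 u v| - 1)_0 = m
                Σ ℕ λ p' → ⟨ m , p' ⟩ ≡ length (tp ++ true ∷ u ++ v) ∸ 1
    condC : ∀ n sn tn → 0 < n → length sn ≡ n → E sn tn →
              Σ ℕ λ q → Σ (List Bool) λ sq → Σ (List Bool) λ tq → Σ (List Bool) λ w →
                q < n × length sq ≡ q × E sq tq ×
                sn ≡ sq ++ false ∷ w × tn ≡ tq ++ true ∷ w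

InTree : (List Bool → List Bool → Set) → List Bool → List Bool → Set
InTree E s t =
  (s ≡ [] × t ≡ []) ⊎
  (Σ (List Bool) λ sq → Σ (List Bool) λ tq → Σ (List Bool) λ w →
     E sq tq × s ≡ sq ++ false ∷ w × t ≡ tq ++ true ∷ w)

Body : (List Bool → List Bool → Set) → Cantor → Cantor → Set
Body E α β = ∀ r → InTree E (prefix α r) (prefix β r)

-- G is a dense G_δ: G = ⋂_n U_n with U_n = ⋃ {[s] : W n s} open and dense
IsDenseGδ : (Cantor → Set) → Set₁
IsDenseGδ G =
  Σ (ℕ → List Bool → Set) λ W →
    (∀ n (s : List Bool) → Σ Cantor λ β →
        prefix β (length s) ≡ s × Σ ℕ λ k → W n (prefix β k)) ×
    (∀ α → G α ⇔ (∀ n → Σ ℕ λ k → W n (prefix α k)))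

Continuous : (Cantor → Cantor) → Set
Continuous f = ∀ α n → Σ ℕ λ k → ∀ β →
  prefix α k ≡ prefix β k → prefix (f α) n ≡ prefix (f β) n

-- The proof is a fusion construction.  The finite binary sequences h are
-- the nodes of a binary tree, numbered so that node n+1 is child (n mod 2)
-- of node ⌊n/2⌋.  Node i carries a pair (s , t) ∈ E and a tail x: s0x
-- approximates α₀ and t1x approximates f α for every α extending h.  Its
-- invariant (Faithful) is that s0 and t1 differ exactly at 0 and, for each
-- 1-bit k of h, at one position ⟨ col k , b ⟩ + 1.  Stage n+1 builds node
-- n+1 from its parent: extend the parent's tail until s0x reaches the
-- current approximation of α₀; for a bit 1 branch by condition (b) of the
-- test, which puts the new difference into column col |h|; then extend the
-- tail, and the approximation of α₀, into the next open dense set.  α₀ and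
-- f α are the limits; (i) and (ii) follow from the invariant because the
-- codes p(t m'), m' ∈ ω, fill exactly the column of p(t m).
module Submission where

open import Defs
open import Data.Nat using (ℕ; zero; suc; _+_; _∸_; _<_; _≤_; z≤n; s≤s; _≤?_; ⌊_/2⌋)
open import Data.Nat.Properties
open import Data.Nat.Induction using (<-rec)
open import Data.Bool using (Bool; true; false; _xor_)
open import Data.Bool.Properties using (xor-same)
open import Data.List using (List; []; _∷_; _++_; length; take; [_])
open import Data.List.Properties using (length-++; ++-assoc; ++-identityʳ; foldl-∷ʳ)
open import Data.List.NonEmpty using (_∷_; _∷ʳ_)
open import Data.Product using (Σ; _×_; _,_; proj₁; proj₂)
open import Data.Sum using (_⊎_; inj₁; inj₂; [_,_]′)
open import Data.Empty using (⊥-elim)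
open import Function.Base using (_∘′_)
open import Function.Bundles using (Equivalence)
open import Relation.Nullary using (yes; no)
open import Relation.Binary.PropositionalEquality hiding ([_])

infix 4 _≼_
_≼_ : List Bool → List Bool → Set
L ≼ M = Σ (List Bool) λ y → M ≡ L ++ y

≼-refl : ∀ L → L ≼ L
≼-refl L = [] , sym (++-identityʳ L)

≡⇒≼ : ∀ {L M} → L ≡ M → L ≼ M
≡⇒≼ {L} refl = ≼-refl L

≼-++ : ∀ L y → L ≼ L ++ y
≼-++ L y = y , refl

≼-trans : ∀ {L M N} → L ≼ M → M ≼ N → L ≼ N
≼-trans {L} (y , refl) (z , refl) = y ++ z , ++-assoc L y z

≼-length : ∀ {L M} → L ≼ M → length L ≤ length M
≼-length {L} (y , refl) = subst (length L ≤_) (sym (length-++ L)) (m≤m+n _ _)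

-- The j-th entry of a finite sequence, read as 0 beyond its end.
bit : List Bool → ℕ → Bool
bit []       _       = false
bit (x ∷ xs) zero    = x
bit (x ∷ xs) (suc j) = bit xs j

bit-++ : ∀ L y {j} → j < length L → bit (L ++ y) j ≡ bit L j
bit-++ (x ∷ L) y {zero}  _         = refl
bit-++ (x ∷ L) y {suc j} (s≤s j<L) = bit-++ L y j<L

bit-≼ : ∀ {L M j} → L ≼ M → j < length L → bit M j ≡ bit L j
bit-≼ {L} (y , refl) = bit-++ L y

bit-true⇒< : ∀ L {j} → bit L j ≡ true → j < length L
bit-true⇒< (x ∷ L) {zero}  _ = s≤s z≤n
bit-true⇒< (x ∷ L) {suc j} e = s≤s (bit-true⇒< L e)

bit-snoc : ∀ h b k → bit (h ++ [ b ]) k ≡ true → bit h k ≡ true ⊎ (k ≡ length h × b ≡ true)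
bit-snoc []      b zero    e = inj₂ (refl , e)
bit-snoc (x ∷ h) b zero    e = inj₁ e
bit-snoc (x ∷ h) b (suc k) e with bit-snoc h b k e
... | inj₁ old          = inj₁ old
... | inj₂ (k≡h , b≡1) = inj₂ (cong suc k≡h , b≡1)

bit-last : ∀ h b → bit (h ++ [ b ]) (length h) ≡ b
bit-last []      b = refl
bit-last (x ∷ h) b = bit-last h b

bit-snoc-old : ∀ h b {k} → bit h k ≡ true → bit (h ++ [ b ]) k ≡ true
bit-snoc-old h b {k} e = trans (bit-++ h [ b ] (bit-true⇒< h e)) e

prefix-length : ∀ α n → length (prefix α n) ≡ n
prefix-length α zero    = refl
prefix-length α (suc n) = cong suc (prefix-length (λ k → α (suc k)) n)

prefix-bit : ∀ α {n j} → j < n → bit (prefix α n) j ≡ α j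
prefix-bit α {suc n} {zero}  _         = refl
prefix-bit α {suc n} {suc j} (s≤s j<n) = prefix-bit (λ k → α (suc k)) j<n

bit-prefix-true : ∀ α {n k} → bit (prefix α n) k ≡ true → α k ≡ true
bit-prefix-true α {n} {k} e =
  trans (sym (prefix-bit α (subst (k <_) (prefix-length α n) (bit-true⇒< (prefix α n) e)))) e

prefix-++ : ∀ α a b → prefix α (a + b) ≡ prefix α a ++ prefix (λ i → α (a + i)) b
prefix-++ α zero    b = refl
prefix-++ α (suc a) b = cong (α 0 ∷_) (prefix-++ (λ k → α (suc k)) a b)

prefix-snoc : ∀ α k → prefix α (suc k) ≡ prefix α k ++ [ α k ]
prefix-snoc α zero    = refl
prefix-snoc α (suc k) = cong (α 0 ∷_) (prefix-snoc (λ i → α (suc i)) k)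

prefix-≼ : ∀ α {m n} → m ≤ n → prefix α m ≼ prefix α n
prefix-≼ α {m} {n} m≤n = prefix (λ i → α (m + i)) (n ∸ m) ,
  trans (cong (prefix α) (sym (m+[n∸m]≡n m≤n))) (prefix-++ α m (n ∸ m))

prefix-cong : ∀ α β n → (∀ j → j < n → α j ≡ β j) → prefix α n ≡ prefix β n
prefix-cong α β zero    _ = refl
prefix-cong α β (suc n) h = cong₂ _∷_ (h 0 (s≤s z≤n))
  (prefix-cong (λ k → α (suc k)) (λ k → β (suc k)) n (λ j j<n → h (suc j) (s≤s j<n)))

prefix-take : ∀ α {r n} → r ≤ n → take r (prefix α n) ≡ prefix α r
prefix-take α {zero}          _         = refl
prefix-take α {suc r} {suc n} (s≤s r≤n) = cong (α 0 ∷_) (prefix-take (λ k → α (suc k)) r≤n)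

Extends : Cantor → List Bool → Set
Extends α L = prefix α (length L) ≡ L

extends-by-bits : ∀ α L → (∀ j → j < length L → α j ≡ bit L j) → Extends α L
extends-by-bits α []      _ = refl
extends-by-bits α (x ∷ L) h = cong₂ _∷_ (h 0 (s≤s z≤n))
  (extends-by-bits (λ k → α (suc k)) L (λ j j<L → h (suc j) (s≤s j<L)))

extends-bit : ∀ {α L} j → Extends α L → j < length L → α j ≡ bit L j
extends-bit {α} {L} j ext j<L = trans (sym (prefix-bit α j<L)) (cong (λ M → bit M j) ext)

extends-≼ : ∀ {α L M} → Extends α M → L ≼ M → Extends α L
extends-≼ {α} {L} ext L≼M = extends-by-bits α L λ j j<L →
  trans (extends-bit j ext (≤-trans j<L (≼-length L≼M))) (bit-≼ L≼M j<L)

extends-take : ∀ {α L} r → Extends α L → r ≤ length L → prefix α r ≡ take r L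
extends-take {α} {L} r ext r≤L = trans (sym (prefix-take α r≤L)) (cong (take r) ext)

limit : (ℕ → List Bool) → Cantor
limit C j = bit (C (suc j)) j

limit-extends : (C : ℕ → List Bool) → (∀ k → C k ≼ C (suc k)) →
  (∀ k → suc k ≤ length (C k)) → ∀ n → Extends (limit C) (C n)
limit-extends C grow long n = extends-by-bits (limit C) (C n) agree
  where
  chain : ∀ {m} k → m ≤ k → C m ≼ C k
  chain zero    z≤n   = ≼-refl _
  chain (suc k) m≤1+k with m≤n⇒m<n∨m≡n m≤1+k
  ... | inj₁ m<1+k = ≼-trans (chain k (≤-pred m<1+k)) (grow k)
  ... | inj₂ refl  = ≼-refl _

  agree : ∀ j → j < length (C n) → limit C j ≡ bit (C n) j
  agree j j<Cn with ≤-total (suc j) n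
  ... | inj₁ 1+j≤n = sym (bit-≼ (chain n 1+j≤n) (<-trans (n<1+n j) (long (suc j))))
  ... | inj₂ n≤1+j = bit-≼ (chain (suc j) n≤1+j) j<Cn

Dense : (ℕ → List Bool → Set) → Set
Dense W = ∀ n (s : List Bool) → Σ Cantor λ β →
  prefix β (length s) ≡ s × Σ ℕ λ k → W n (prefix β k)

Hits : (ℕ → List Bool → Set) → ℕ → List Bool → Set
Hits W n M = Σ (List Bool) λ L → W n L × L ≼ M

enter : ∀ {W} → Dense W → ∀ n L → Σ (List Bool) λ y → 0 < length y × Hits W n (L ++ y)
enter {W} dense n L with dense n L
... | γ , γ⊇L , k , w = y , 0<y , prefix γ k , w , subst (prefix γ k ≼_) L++y≡ (prefix-≼ γ k≤K)
  where
  y = prefix (λ i → γ (length L + i)) (suc k)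
  0<y : 0 < length y
  0<y = subst (0 <_) (sym (prefix-length (λ i → γ (length L + i)) (suc k))) (s≤s z≤n)
  k≤K : k ≤ length L + suc k
  k≤K = ≤-trans (n≤1+n k) (m≤n+m (suc k) (length L))
  L++y≡ : prefix γ (length L + suc k) ≡ L ++ y
  L++y≡ = trans (prefix-++ γ (length L) (suc k)) (cong (_++ y) γ⊇L)

hits-extends : ∀ {W n M α} → Hits W n M → Extends α M → Σ ℕ λ k → W n (prefix α k)
hits-extends {W} {n} (L , w , L≼M) ext = length L , subst (W n) (sym (extends-≼ ext L≼M)) w

-- Cantor pairing ⟨ a , b ⟩ = tri (a + b) + b is inverted by counting along
-- the diagonals: after (0 , b) comes (b + 1 , 0), after (a + 1 , b) comes (a , b + 1).
nextPair : ℕ × ℕ → ℕ × ℕ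
nextPair (zero  , b) = suc b , 0
nextPair (suc a , b) = a , suc b

unpair : ℕ → ℕ × ℕ
unpair zero    = 0 , 0
unpair (suc k) = nextPair (unpair k)

col : ℕ → ℕ
col k = proj₁ (unpair k)

-- ⟨_,_⟩ maps each pair to the next number, so it inverts unpair.
pair-next : ∀ a b → let (a' , b') = nextPair (a , b) in ⟨ a' , b' ⟩ ≡ suc ⟨ a , b ⟩
pair-next zero    b rewrite +-identityʳ b = cong suc (trans (+-identityʳ _) (+-comm b (tri b)))
pair-next (suc a) b rewrite +-suc a b     = +-suc (tri (suc (a + b))) b

pair-unpair : ∀ k → ⟨ proj₁ (unpair k) , proj₂ (unpair k) ⟩ ≡ k
pair-unpair zero    = refl
pair-unpair (suc k) = trans (pair-next (proj₁ (unpair k)) (proj₂ (unpair k))) (cong suc (pair-unpair k))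

unpair-onto : ∀ n a b → a + b ≡ n → Σ ℕ λ k → unpair k ≡ (a , b)
unpair-onto n       a       (suc b) a+b≡n
  with unpair-onto n (suc a) b (trans (sym (+-suc a b)) a+b≡n)
... | k , e = suc k , cong nextPair e
unpair-onto zero    zero    zero    _     = 0 , refl
unpair-onto (suc n) (suc a) zero    a+0≡n
  with unpair-onto n zero a (trans (sym (+-identityʳ a)) (suc-injective a+0≡n))
... | k , e = suc k , cong nextPair e

unpair-pair : ∀ a b → unpair ⟨ a , b ⟩ ≡ (a , b)
unpair-pair a b with unpair-onto (a + b) a b refl
... | k , e = trans (cong unpair (sym k≡ab)) e
  where
  k≡ab : k ≡ ⟨ a , b ⟩
  k≡ab = trans (sym (pair-unpair k)) (cong (λ (x , y) → ⟨ x , y ⟩) e)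

col-pair : ∀ a b → col ⟨ a , b ⟩ ≡ a
col-pair a b = cong proj₁ (unpair-pair a b)

pcode-snoc : ∀ x xs m → pcode ((x ∷ xs) ∷ʳ m) ≡ ⟨ pcode (x ∷ xs) , m ⟩
pcode-snoc x xs m = foldl-∷ʳ ⟨_,_⟩ x m xs

sibling-code : ∀ t m b → Σ ℕ λ m' → pcode (t ∷ʳ m') ≡ ⟨ col (pcode (t ∷ʳ m)) , b ⟩
sibling-code []       m b = ⟨ col m , b ⟩ , refl
sibling-code (x ∷ xs) m b = b , (begin
  pcode ((x ∷ xs) ∷ʳ b)               ≡⟨ pcode-snoc x xs b ⟩
  ⟨ pcode (x ∷ xs) , b ⟩              ≡⟨ cong ⟨_, b ⟩ (sym (col-pair (pcode (x ∷ xs)) m)) ⟩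
  ⟨ col ⟨ pcode (x ∷ xs) , m ⟩ , b ⟩  ≡⟨ cong (λ c → ⟨ col c , b ⟩) (sym (pcode-snoc x xs m)) ⟩
  ⟨ col (pcode ((x ∷ xs) ∷ʳ m)) , b ⟩ ∎)
  where open ≡-Reasoning

column-code : ∀ t m k b → pcode (t ∷ʳ m) ≡ ⟨ col k , b ⟩ → Σ ℕ λ m' → pcode (t ∷ʳ m') ≡ k
column-code []       m k b _ = k , refl
column-code (x ∷ xs) m k b e = proj₂ (unpair k) , (begin
  pcode ((x ∷ xs) ∷ʳ proj₂ (unpair k)) ≡⟨ pcode-snoc x xs _ ⟩
  ⟨ pcode (x ∷ xs) , proj₂ (unpair k) ⟩ ≡⟨ cong ⟨_, proj₂ (unpair k) ⟩ t≡col ⟩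
  ⟨ col k , proj₂ (unpair k) ⟩          ≡⟨ pair-unpair k ⟩
  k                                      ∎)
  where
  open ≡-Reasoning
  t≡col : pcode (x ∷ xs) ≡ col k
  t≡col = begin
    pcode (x ∷ xs)                ≡⟨ sym (col-pair _ m) ⟩
    col ⟨ pcode (x ∷ xs) , m ⟩    ≡⟨ cong col (trans (sym (pcode-snoc x xs m)) e) ⟩
    col ⟨ col k , b ⟩             ≡⟨ col-pair (col k) b ⟩
    col k                          ∎

take-++-short : ∀ r (u y : List Bool) → r ≤ length u → take r (u ++ y) ≡ take r u
take-++-short zero    u       y _         = refl
take-++-short (suc r) (b ∷ u) y (s≤s r≤u) = cong (b ∷_) (take-++-short r u y r≤u)

take-++-long : ∀ r (u x : List Bool) b → length u < r →
  take r (u ++ b ∷ x) ≡ u ++ b ∷ take (r ∸ suc (length u)) x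
take-++-long (suc r) []      x b _         = refl
take-++-long (suc r) (c ∷ u) x b (s≤s u<r) = cong (c ∷_) (take-++-long r u x b u<r)

-- Condition (c) makes a test generate its branches: whenever E s t, every
-- initial segment of (s0x , t1x) lies in the tree generated by E.  By
-- strong induction on |s|, unfolding (s , t) to its predecessor in E.
branch-in-tree : ∀ {E} → IsTest E → ∀ {s t} → E s t → ∀ r x →
  InTree E (take r (s ++ false ∷ x)) (take r (t ++ true ∷ x))
branch-in-tree {E} test {s} {t} e = <-rec Branches step (length s) s t refl e
  where
  open IsTest test
  Branches : ℕ → Set
  Branches q = ∀ s t → length s ≡ q → E s t → ∀ r x →
    InTree E (take r (s ++ false ∷ x)) (take r (t ++ true ∷ x))

  step : ∀ q → (∀ {q'} → q' < q → Branches q') → Branches q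
  step _ rec s t refl e r x with r ≤? length s
  ... | no r≰s = inj₂ (s , t , take (r ∸ suc (length s)) x , e ,
    take-++-long r s x false s<r ,
    subst (λ l → take r (t ++ true ∷ x) ≡ t ++ true ∷ take (r ∸ suc l) x)
          (sym s≡t) (take-++-long r t x true (subst (_< r) s≡t s<r)))
    where
    s<r = ≰⇒> r≰s
    s≡t = sameLength s t e
  step _ rec []      t refl e .zero x | yes z≤n = inj₁ (refl , refl)
  step _ rec (b ∷ s) t refl e r     x | yes r≤s
    with condC (length (b ∷ s)) (b ∷ s) t (s≤s z≤n) refl e
  ... | q' , s' , t' , w , q'<q , s'≡q' , e' , s≡ , t≡ =
    subst₂ (InTree E)
      (sym (trans (take-++-short r (b ∷ s) _ r≤s) (cong (take r) s≡)))
      (sym (trans (take-++-short r t _ (subst (r ≤_) (sameLength _ t e) r≤s)) (cong (take r) t≡)))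
      (rec q'<q s' t' s'≡q' e' r w)

differ : List Bool → List Bool → ℕ → Bool
differ L M j = bit L j xor bit M j

differ-tail : ∀ s t x j → length s ≡ length t →
  differ (s ++ false ∷ x) (t ++ true ∷ x) j ≡ differ (s ++ [ false ]) (t ++ [ true ]) j
differ-tail []      []      x zero    _ = refl
differ-tail []      []      x (suc j) _ = xor-same (bit x j)
differ-tail (a ∷ s) (b ∷ t) x zero    _ = refl
differ-tail (a ∷ s) (b ∷ t) x (suc j) e = differ-tail s t x j (suc-injective e)

differ-bound : ∀ s t x j → length s ≡ length t →
  differ (s ++ [ false ]) (t ++ [ true ]) j ≡ true → j < length (t ++ true ∷ x)
differ-bound []      []      x zero    _ _ = s≤s z≤n
differ-bound (a ∷ s) (b ∷ t) x zero    _ _ = s≤s z≤n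
differ-bound (a ∷ s) (b ∷ t) x (suc j) e d = s≤s (differ-bound s t x j (suc-injective e) d)

differ-last : ∀ w j → differ (w ++ [ false ]) (w ++ [ true ]) j ≡ true → j ≡ length w
differ-last []      zero    _ = refl
differ-last (false ∷ w) zero ()
differ-last (true  ∷ w) zero ()
differ-last (b ∷ w) (suc j) d = cong suc (differ-last w j d)

differ-keep : ∀ s t w j → length s ≡ length t →
  differ (s ++ [ false ]) (t ++ [ true ]) j ≡ true →
  differ ((s ++ false ∷ w) ++ [ false ]) ((t ++ true ∷ w) ++ [ true ]) j ≡ true
differ-keep []      []      w zero    _ _ = refl
differ-keep (a ∷ s) (b ∷ t) w zero    _ d = d
differ-keep (a ∷ s) (b ∷ t) w (suc j) e d = differ-keep s t w j (suc-injective e) d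

differ-new : ∀ s t w → length s ≡ length t →
  differ ((s ++ false ∷ w) ++ [ false ]) ((t ++ true ∷ w) ++ [ true ]) (suc (length s + length w)) ≡ true
differ-new []      []      w _ = cong₂ _xor_ (bit-last w false) (bit-last w true)
differ-new (a ∷ s) (b ∷ t) w e = differ-new s t w (suc-injective e)

differ-only : ∀ s t w j → length s ≡ length t →
  differ ((s ++ false ∷ w) ++ [ false ]) ((t ++ true ∷ w) ++ [ true ]) j ≡ true →
  differ (s ++ [ false ]) (t ++ [ true ]) j ≡ true ⊎ j ≡ suc (length s + length w)
differ-only []      []      w zero    _ _ = inj₁ refl
differ-only []      []      w (suc j) _ d = inj₂ (cong suc (differ-last w j d))
differ-only (a ∷ s) (b ∷ t) w zero    _ d = inj₁ d
differ-only (a ∷ s) (b ∷ t) w (suc j) e d with differ-only s t w j (suc-injective e) d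
... | inj₁ old = inj₁ old
... | inj₂ new = inj₂ (cong suc new)

-- A node of the construction: the finite sequence hist it serves, a pair
-- (s , t) (in E, once built) and a common tail; left = s0·tail approximates
-- α₀ and right = t1·tail approximates f α for α extending hist.
record Node : Set where
  constructor node
  field
    hist s t tail : List Bool
open Node

left right : Node → List Bool
left  nd = s nd ++ false ∷ tail nd
right nd = t nd ++ true  ∷ tail nd

mismatch : Node → ℕ → Bool
mismatch nd = differ (s nd ++ [ false ]) (t nd ++ [ true ])

left-right-length : ∀ nd → length (s nd) ≡ length (t nd) → length (left nd) ≡ length (right nd)
left-right-length nd e
  rewrite length-++ (s nd) {false ∷ tail nd} | length-++ (t nd) {true ∷ tail nd} | e = refl

withTail : Node → List Bool → Node
withTail nd y = record nd { tail = tail nd ++ y }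

left-withTail : ∀ nd y → left (withTail nd y) ≡ left nd ++ y
left-withTail nd y = sym (++-assoc (s nd) (false ∷ tail nd) y)

right-withTail : ∀ nd y → right (withTail nd y) ≡ right nd ++ y
right-withTail nd y = sym (++-assoc (t nd) (true ∷ tail nd) y)

-- Positions j allowed to carry a difference for the history h: position 0
-- (the root split) and positions ⟨ col k , b ⟩ + 1 with h(k) = 1.
Marked : List Bool → ℕ → Set
Marked h j = j ≡ 0 ⊎ Σ ℕ λ k → bit h k ≡ true × Σ ℕ λ b → j ≡ suc ⟨ col k , b ⟩

marked-snoc : ∀ h b {j} → Marked h j → Marked (h ++ [ b ]) j
marked-snoc h b (inj₁ j≡0)             = inj₁ j≡0
marked-snoc h b (inj₂ (k , hk , c , e)) = inj₂ (k , bit-snoc-old h b hk , c , e)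

record Faithful (nd : Node) : Set where
  field
    realised  : ∀ k → bit (hist nd) k ≡ true → Σ ℕ λ b → mismatch nd (suc ⟨ col k , b ⟩) ≡ true
    explained : ∀ j → mismatch nd j ≡ true → Marked (hist nd) j

faithful-withTail : ∀ nd y → Faithful nd → Faithful (withTail nd y)
faithful-withTail nd y fa = record { realised = realised ; explained = explained }
  where open Faithful fa

faithful-skip : ∀ nd → Faithful nd → Faithful (record nd { hist = hist nd ++ [ false ] })
faithful-skip nd fa = record
  { realised  = λ k hk → realised′ k (bit-snoc (hist nd) false k hk)
  ; explained = λ j d → marked-snoc (hist nd) false (explained j d) }
  where
  open Faithful fa
  realised′ : ∀ k → bit (hist nd) k ≡ true ⊎ (k ≡ length (hist nd) × false ≡ true) →
    Σ ℕ λ b → mismatch nd (suc ⟨ col k , b ⟩) ≡ true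
  realised′ k (inj₁ hk) = realised k hk

faithful-split : ∀ nd w b → length (s nd) ≡ length (t nd) → Faithful nd →
  length (s nd) + length w ≡ ⟨ col (length (hist nd)) , b ⟩ →
  Faithful (node (hist nd ++ [ true ]) (s nd ++ false ∷ w) (t nd ++ true ∷ w) [])
faithful-split nd w b s≡t fa pos = record
  { realised  = λ k hk → realised′ k (bit-snoc (hist nd) true k hk)
  ; explained = explained′ }
  where
  open Faithful fa
  child = node (hist nd ++ [ true ]) (s nd ++ false ∷ w) (t nd ++ true ∷ w) []

  realised′ : ∀ k → bit (hist nd) k ≡ true ⊎ (k ≡ length (hist nd) × true ≡ true) →
    Σ ℕ λ c → mismatch child (suc ⟨ col k , c ⟩) ≡ true
  realised′ k (inj₁ hk) with realised k hk
  ... | c , d = c , differ-keep (s nd) (t nd) w _ s≡t d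
  realised′ _ (inj₂ (refl , _)) =
    b , subst (λ j → mismatch child j ≡ true) (cong suc pos) (differ-new (s nd) (t nd) w s≡t)

  explained′ : ∀ j → mismatch child j ≡ true → Marked (hist child) j
  explained′ j d with differ-only (s nd) (t nd) w j s≡t d
  ... | inj₁ old = marked-snoc (hist nd) true (explained j old)
  ... | inj₂ new = inj₂ (length (hist nd) , bit-last (hist nd) true , b , trans new (cong suc pos))

Δ-mismatch : ∀ nd {α β j} → length (s nd) ≡ length (t nd) →
  Extends α (left nd) → Extends β (right nd) → j < length (right nd) →
  (α Δ β) j ≡ mismatch nd j
Δ-mismatch nd {j = j} s≡t α⊇ β⊇ j<r =
  trans (cong₂ _xor_ (extends-bit j α⊇ (subst (j <_) (sym (left-right-length nd s≡t)) j<r))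
                     (extends-bit j β⊇ j<r))
        (differ-tail (s nd) (t nd) (tail nd) j s≡t)

-- Children in the binary tree of nodes: child b of node h is node
-- childCode h b + 1, where childCode h b = 2h + b; so node n + 1 is child
-- (odd n) of node ⌊ n /2⌋.
odd : ℕ → Bool
odd zero          = false
odd (suc zero)    = true
odd (suc (suc n)) = odd n

childCode : ℕ → Bool → ℕ
childCode zero    false = 0
childCode zero    true  = 1
childCode (suc h) b     = suc (suc (childCode h b))

half-childCode : ∀ h b → ⌊ childCode h b /2⌋ ≡ h
half-childCode zero    false = refl
half-childCode zero    true  = refl
half-childCode (suc h) b     = cong suc (half-childCode h b)

odd-childCode : ∀ h b → odd (childCode h b) ≡ b
odd-childCode zero    false = refl
odd-childCode zero    true  = refl
odd-childCode (suc h) b     = odd-childCode h b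

≤-childCode : ∀ h b → h ≤ childCode h b
≤-childCode zero    b = z≤n
≤-childCode (suc h) b = s≤s (m≤n⇒m≤1+n (≤-childCode h b))

extendTable : ∀ {A : Set} → (ℕ → A) → ℕ → A → ℕ → A
extendTable tab n a i with i ≤? n
... | yes _ = tab i
... | no  _ = a

extendTable-old : ∀ {A : Set} (tab : ℕ → A) n a {i} → i ≤ n → extendTable tab n a i ≡ tab i
extendTable-old tab n a {i} i≤n with i ≤? n
... | yes _   = refl
... | no  i≰n = ⊥-elim (i≰n i≤n)

extendTable-new : ∀ {A : Set} (tab : ℕ → A) n a → extendTable tab n a (suc n) ≡ a
extendTable-new tab n a with suc n ≤? n
... | yes 1+n≤n = ⊥-elim (1+n≰n 1+n≤n)
... | no  _     = refl

extendTable-all : ∀ {A : Set} (P : ℕ → A → Set) (tab : ℕ → A) n a →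
  (∀ i → i ≤ n → P i (tab i)) → P (suc n) a → ∀ i → i ≤ suc n → P i (extendTable tab n a i)
extendTable-all P tab n a old new i i≤1+n with i ≤? n
... | yes i≤n = old i i≤n
... | no  i≰n = subst (λ j → P j a) (sym (≤-antisym i≤1+n (≰⇒> i≰n))) new

++-regroup : ∀ (r : List Bool) b u v w → (r ++ b ∷ u ++ v) ++ w ≡ (r ++ b ∷ u) ++ (v ++ w)
++-regroup r b u v w = begin
  (r ++ b ∷ u ++ v) ++ w    ≡⟨ ++-assoc r (b ∷ u ++ v) w ⟩
  r ++ b ∷ (u ++ v) ++ w    ≡⟨ cong (λ z → r ++ b ∷ z) (++-assoc u v w) ⟩
  r ++ b ∷ u ++ v ++ w      ≡⟨ sym (++-assoc r (b ∷ u) (v ++ w)) ⟩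
  (r ++ b ∷ u) ++ (v ++ w)  ∎
  where open ≡-Reasoning

length-∷-pred : ∀ (u w : List Bool) b → length (u ++ b ∷ w) ∸ 1 ≡ length u + length w
length-∷-pred u w b rewrite length-++ u {b ∷ w} | +-suc (length u) (length w) = refl

length≡0 : ∀ {L : List Bool} → length L ≡ 0 → L ≡ []
length≡0 {[]} _ = refl

module Construction (W : ℕ → List Bool → Set) (dense : Dense W)
                    (E : List Bool → List Bool → Set) (test : IsTest E) where
  open IsTest test

  record Good (i : ℕ) (nd : Node) : Set where
    field
      inE      : E (s nd) (t nd)
      faithful : Faithful nd
      long     : suc i ≤ length (right nd)
      hits     : Hits W (length (hist nd)) (right nd)

  record Child (p : Node) (b : Bool) (c : Node) : Set where
    field
      inE        : E (s c) (t c)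
      faithful   : Faithful c
      history    : hist c ≡ hist p ++ [ b ]
      leftGrows  : left p ≼ left c
      rightGrows : right p ≼ right c

  -- A 0 keeps the pair; a 1 branches at the end of the tail by condition (b)
  -- with m = col |hist p|, which puts the new difference into that column.
  child : ∀ b p → E (s p) (t p) → Faithful p → Σ Node (Child p b)
  child false p e fa = record p { hist = hist p ++ [ false ] } , record
    { inE = e ; faithful = faithful-skip p fa ; history = refl
    ; leftGrows = ≼-refl (left p) ; rightGrows = ≼-refl (right p) }
  child true p e fa with condB (col (length (hist p))) (length (s p)) (tail p) (s p) (t p) refl e
  ... | v , e′ , b , pos = c , record
    { inE = e′ ; faithful = faithful-split p w b s≡t fa pos′ ; history = refl
    ; leftGrows  = v ++ [ false ] , ++-regroup (s p) false (tail p) v [ false ]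
    ; rightGrows = v ++ [ true ]  , ++-regroup (t p) true  (tail p) v [ true ] }
    where
    w = tail p ++ v
    c = node (hist p ++ [ true ]) (s p ++ false ∷ w) (t p ++ true ∷ w) []
    s≡t = sameLength (s p) (t p) e
    pos′ : length (s p) + length w ≡ ⟨ col (length (hist p)) , b ⟩
    pos′ = trans (cong (_+ length w) s≡t) (sym (trans pos (length-∷-pred (t p) w true)))

  record Offspring (n : ℕ) (A : List Bool) (p : Node) (b : Bool) (c : Node) : Set where
    field
      good       : Good (suc n) c
      history    : hist c ≡ hist p ++ [ b ]
      leftGrows  : A ≼ left c
      rightGrows : right p ≼ right c

  offspring : ∀ {i} n A p b → Good i p → left p ≼ A → suc n ≤ length A →
    Σ Node (Offspring n A p b)
  offspring n A p b gp (z , A≡) n<A = c′ , record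
    { good       = record { inE = C.inE ; faithful = faithful-withTail c y C.faithful
                          ; long = long ; hits = hits }
    ; history    = C.history
    ; leftGrows  = ≼-trans (≡⇒≼ A≡p′) (≼-trans C.leftGrows (y , left-withTail c y))
    ; rightGrows = ≼-trans (z , right-withTail p z) (≼-trans C.rightGrows (y , right-withTail c y)) }
    where
    p′ = withTail p z
    A≡p′ : A ≡ left p′
    A≡p′ = trans A≡ (sym (left-withTail p z))
    p∈E : E (s p) (t p)
    p∈E = Good.inE gp
    ch = child b p′ p∈E (faithful-withTail p z (Good.faithful gp))
    c = proj₁ ch
    module C = Child (proj₂ ch)
    en = enter {W} dense (length (hist c)) (right c)
    y = proj₁ en
    c′ = withTail c y
    hits : Hits W (length (hist c)) (right c′)
    hits = subst (Hits W _) (sym (right-withTail c y)) (proj₂ (proj₂ en))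
    long : suc (suc n) ≤ length (right c′)
    long = begin
      suc (suc n)                 ≤⟨ s≤s n<A ⟩
      suc (length A)              ≡⟨ cong (suc ∘′ length) A≡p′ ⟩
      suc (length (left p′))      ≡⟨ cong suc (left-right-length p′ (sameLength (s p) (t p) p∈E)) ⟩
      suc (length (right p′))     ≤⟨ s≤s (≼-length C.rightGrows) ⟩
      suc (length (right c))      ≤⟨ m<m+n (length (right c)) (proj₁ (proj₂ en)) ⟩
      length (right c) + length y ≡⟨ sym (length-++ (right c)) ⟩
      length (right c ++ y)       ≡⟨ cong length (sym (right-withTail c y)) ⟩
      length (right c′)           ∎
      where open ≤-Reasoning

  -- A stage: the current approximation of α₀ and the table of nodes built
  -- so far (meaningful at indices ≤ n).
  record Stage : Set where
    constructor stage
    field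
      approx : List Bool
      table  : ℕ → Node
  open Stage

  record Inv (n : ℕ) (st : Stage) : Set where
    field
      good  : ∀ i → i ≤ n → Good i (table st i)
      below : ∀ i → i ≤ n → left (table st i) ≼ approx st
      long  : suc n ≤ length (approx st)
      hits  : Hits W n (approx st)

  record Next (n : ℕ) (st st′ : Stage) : Set where
    field
      approxGrows : approx st ≼ approx st′
      tableKept   : ∀ i → i ≤ n → table st′ i ≡ table st i
      history     : hist (table st′ (suc n)) ≡ hist (table st ⌊ n /2⌋) ++ [ odd n ]
      rightGrows  : right (table st ⌊ n /2⌋) ≼ right (table st′ (suc n))

  step : ∀ n → (r : Σ Stage (Inv n)) →
    Σ (Σ Stage (Inv (suc n))) λ r′ → Next n (proj₁ r) (proj₁ r′)
  step n (st , inv) = (stage A′ table′ , inv′) , grows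
    where
    open Inv inv
    par≤n = ⌊n/2⌋≤n n
    off = offspring n (approx st) (table st ⌊ n /2⌋) (odd n) (good _ par≤n) (below _ par≤n) long
    c = proj₁ off
    module O = Offspring (proj₂ off)
    en = enter {W} dense (suc n) (left c)
    A′ = left c ++ proj₁ en
    table′ = extendTable (table st) n c
    A≼A′ : approx st ≼ A′
    A≼A′ = ≼-trans O.leftGrows (≼-++ (left c) (proj₁ en))
    inv′ : Inv (suc n) (stage A′ table′)
    inv′ = record
      { good  = extendTable-all Good (table st) n c good O.good
      ; below = extendTable-all (λ _ nd → left nd ≼ A′) (table st) n c
                  (λ i i≤n → ≼-trans (below i i≤n) A≼A′) (≼-++ (left c) (proj₁ en))
      ; long  = ≤-trans (Good.long O.good)
                  (≤-trans (≤-reflexive (sym (left-right-length c (sameLength _ _ (Good.inE O.good)))))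
                           (≼-length (≼-++ (left c) (proj₁ en))))
      ; hits  = proj₂ (proj₂ en) }
    new = extendTable-new (table st) n c
    grows : Next n st (stage A′ table′)
    grows = record
      { approxGrows = A≼A′
      ; tableKept   = λ i → extendTable-old (table st) n c
      ; history     = trans (cong hist new) O.history
      ; rightGrows  = subst (λ nd → right (table st ⌊ n /2⌋) ≼ right nd) (sym new) O.rightGrows }

  E-empty : E [] []
  E-empty with unique 0
  ... | s₀ , t₀ , (s₀≡0 , e) , _ =
    subst₂ E (length≡0 s₀≡0) (length≡0 (trans (sym (sameLength s₀ t₀ e)) s₀≡0)) e

  root-faithful : ∀ x → Faithful (node [] [] [] x)
  root-faithful x = record { realised = λ _ () ; explained = explained }
    where
    explained : ∀ j → mismatch (node [] [] [] x) j ≡ true → Marked [] j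
    explained zero    _ = inj₁ refl
    explained (suc j) ()

  initial : Σ Stage (Inv 0)
  initial = stage A₀ (λ _ → root) , record
    { good  = λ { .0 z≤n → record { inE = E-empty ; faithful = root-faithful _
                                  ; long = s≤s z≤n ; hits = proj₂ (proj₂ enR) } }
    ; below = λ _ _ → ≼-++ (left root) (proj₁ enA)
    ; long  = s≤s z≤n
    ; hits  = proj₂ (proj₂ enA) }
    where
    enR = enter {W} dense 0 [ true ]
    root = node [] [] [] (proj₁ enR)
    enA = enter {W} dense 0 (left root)
    A₀ = left root ++ proj₁ enA

  run : ∀ n → Σ Stage (Inv n)
  run zero    = initial
  run (suc n) = proj₁ (step n (run n))

  next : ∀ n → Next n (proj₁ (run n)) (proj₁ (run (suc n)))
  next n = proj₂ (step n (run n))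

  α₀-approx : ℕ → List Bool
  α₀-approx n = approx (proj₁ (run n))

  nodeNo : ℕ → Node
  nodeNo i = table (proj₁ (run i)) i

  nodeNo-stable : ∀ i n → i ≤ n → table (proj₁ (run n)) i ≡ nodeNo i
  nodeNo-stable i zero    z≤n = refl
  nodeNo-stable i (suc n) i≤1+n =
    [ earlier , (λ i≡1+n → cong (λ m → table (proj₁ (run m)) i) (sym i≡1+n)) ]′ (m≤n⇒m<n∨m≡n i≤1+n)
    where
    earlier : i < suc n → table (proj₁ (run (suc n))) i ≡ nodeNo i
    earlier i<1+n = trans (Next.tableKept (next n) i (≤-pred i<1+n)) (nodeNo-stable i n (≤-pred i<1+n))

  nodeNo-good : ∀ i → Good i (nodeNo i)
  nodeNo-good i = Inv.good (proj₂ (run i)) i ≤-refl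

  nodeNo-same-length : ∀ i → length (s (nodeNo i)) ≡ length (t (nodeNo i))
  nodeNo-same-length i = sameLength _ _ (Good.inE (nodeNo-good i))

  parent-node : ∀ h b → let n = childCode h b in table (proj₁ (run n)) ⌊ n /2⌋ ≡ nodeNo h
  parent-node h b = trans (nodeNo-stable _ n (⌊n/2⌋≤n n)) (cong nodeNo (half-childCode h b))
    where n = childCode h b

  child-history : ∀ h b → hist (nodeNo (suc (childCode h b))) ≡ hist (nodeNo h) ++ [ b ]
  child-history h b = trans (Next.history (next n))
    (cong₂ (λ nd c → hist nd ++ [ c ]) (parent-node h b) (odd-childCode h b))
    where n = childCode h b

  child-right : ∀ h b → right (nodeNo h) ≼ right (nodeNo (suc (childCode h b)))
  child-right h b = subst (λ nd → right nd ≼ right (nodeNo (suc n))) (parent-node h b)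
    (Next.rightGrows (next n))
    where n = childCode h b

  -- path α k is the number of the node serving α|k.
  path : Cantor → ℕ → ℕ
  path α zero    = 0
  path α (suc k) = suc (childCode (path α k) (α k))

  path-≥ : ∀ α k → k ≤ path α k
  path-≥ α zero    = z≤n
  path-≥ α (suc k) = s≤s (≤-trans (path-≥ α k) (≤-childCode _ (α k)))

  path-cong : ∀ α β k → (∀ i → i < k → α i ≡ β i) → path α k ≡ path β k
  path-cong α β zero    _ = refl
  path-cong α β (suc k) h =
    cong suc (cong₂ childCode (path-cong α β k (λ i i<k → h i (m<n⇒m<1+n i<k))) (h k ≤-refl))

  path-hist : ∀ α k → hist (nodeNo (path α k)) ≡ prefix α k
  path-hist α zero    = refl
  path-hist α (suc k) = begin
    hist (nodeNo (path α (suc k)))     ≡⟨ child-history (path α k) (α k) ⟩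
    hist (nodeNo (path α k)) ++ [ α k ] ≡⟨ cong (_++ [ α k ]) (path-hist α k) ⟩
    prefix α k ++ [ α k ]               ≡⟨ sym (prefix-snoc α k) ⟩
    prefix α (suc k)                    ∎
    where open ≡-Reasoning

  f-approx : Cantor → ℕ → List Bool
  f-approx α k = right (nodeNo (path α k))

  f-approx-long : ∀ α k → suc k ≤ length (f-approx α k)
  f-approx-long α k = ≤-trans (s≤s (path-≥ α k)) (Good.long (nodeNo-good (path α k)))

  α₀ : Cantor
  α₀ = limit α₀-approx

  f : Cantor → Cantor
  f α = limit (f-approx α)

  α₀-extends : ∀ n → Extends α₀ (α₀-approx n)
  α₀-extends = limit-extends α₀-approx (λ n → Next.approxGrows (next n))
                                      (λ n → Inv.long (proj₂ (run n)))

  α₀-extends-left : ∀ i → Extends α₀ (left (nodeNo i))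
  α₀-extends-left i = extends-≼ (α₀-extends i) (Inv.below (proj₂ (run i)) i ≤-refl)

  f-extends : ∀ α k → Extends (f α) (f-approx α k)
  f-extends α = limit-extends (f-approx α) (λ k → child-right (path α k) (α k)) (f-approx-long α)

  α₀-meets-W : ∀ n → Σ ℕ λ k → W n (prefix α₀ k)
  α₀-meets-W n = hits-extends {W} (Inv.hits (proj₂ (run n))) (α₀-extends n)

  f-meets-W : ∀ α n → Σ ℕ λ k → W n (prefix (f α) k)
  f-meets-W α n = subst (λ m → Σ ℕ λ k → W m (prefix (f α) k)) level
    (hits-extends {W} (Good.hits (nodeNo-good (path α n))) (f-extends α n))
    where
    level : length (hist (nodeNo (path α n))) ≡ n
    level = trans (cong length (path-hist α n)) (prefix-length α n)

  -- f α j only depends on α|(j + 1).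
  f-continuous : Continuous f
  f-continuous α n = n , λ β α|n≡β|n → prefix-cong (f α) (f β) n λ j j<n →
    cong (λ h → bit (right (nodeNo h)) j)
         (path-cong α β (suc j) (λ i i≤j → agree β α|n≡β|n (≤-trans i≤j j<n)))
    where
    agree : ∀ β {i} → prefix α n ≡ prefix β n → i < n → α i ≡ β i
    agree β {i} α|n≡β|n i<n =
      trans (sym (prefix-bit α i<n)) (trans (cong (λ L → bit L i) α|n≡β|n) (prefix-bit β i<n))

  -- (α₀ , f α) is a branch of T: its initial segments are those of the
  -- node serving α|r, whose pair lies in E.
  f-branch : ∀ α → Body E α₀ (f α)
  f-branch α r = subst₂ (InTree E) (sym left≡) (sym right≡)
    (branch-in-tree test (Good.inE (nodeNo-good (path α r))) r (tail N))
    where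
    N = nodeNo (path α r)
    r≤right : r ≤ length (right N)
    r≤right = ≤-trans (n≤1+n r) (f-approx-long α r)
    r≤left : r ≤ length (left N)
    r≤left = subst (r ≤_) (sym (left-right-length N (nodeNo-same-length (path α r)))) r≤right
    left≡ : prefix α₀ r ≡ take r (left N)
    left≡ = extends-take r (α₀-extends-left (path α r)) r≤left
    right≡ : prefix (f α) r ≡ take r (right N)
    right≡ = extends-take r (f-extends α r) r≤right

  Δ-along : ∀ α k {j} → j < length (f-approx α k) → (α₀ Δ f α) j ≡ mismatch (nodeNo (path α k)) j
  Δ-along α k = Δ-mismatch (nodeNo (path α k)) (nodeNo-same-length (path α k))
                           (α₀-extends-left (path α k)) (f-extends α k)

  bits-to-differences : ∀ α u m → α (pcode (u ∷ʳ m)) ≡ true →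
    Σ ℕ λ m′ → (α₀ Δ f α) (pcode (u ∷ʳ m′) + 1) ≡ true
  bits-to-differences α u m αk = m′ , (begin
    (α₀ Δ f α) (pcode (u ∷ʳ m′) + 1)  ≡⟨ cong (α₀ Δ f α) (trans (+-comm _ 1) (cong suc code)) ⟩
    (α₀ Δ f α) (suc ⟨ col k , b ⟩)    ≡⟨ Δ-along α (suc k) in-range ⟩
    mismatch N (suc ⟨ col k , b ⟩)     ≡⟨ d ⟩
    true                               ∎)
    where
    open ≡-Reasoning
    k = pcode (u ∷ʳ m)
    N = nodeNo (path α (suc k))
    hist-k : bit (hist N) k ≡ true
    hist-k = trans (cong (λ h → bit h k) (path-hist α (suc k))) (trans (prefix-bit α ≤-refl) αk)
    realised = Faithful.realised (Good.faithful (nodeNo-good (path α (suc k)))) k hist-k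
    b = proj₁ realised
    d = proj₂ realised
    in-range : suc ⟨ col k , b ⟩ < length (right N)
    in-range = differ-bound (s N) (t N) (tail N) _ (nodeNo-same-length (path α (suc k))) d
    m′ = proj₁ (sibling-code u m b)
    code = proj₂ (sibling-code u m b)

  differences-to-bits : ∀ α u m → (α₀ Δ f α) (pcode (u ∷ʳ m) + 1) ≡ true →
    Σ ℕ λ m′ → α (pcode (u ∷ʳ m′)) ≡ true
  differences-to-bits α u m Δj = decode (subst (λ h → Marked h j) (path-hist α j) marked)
    where
    j = pcode (u ∷ʳ m) + 1
    marked : Marked (hist (nodeNo (path α j))) j
    marked = Faithful.explained (Good.faithful (nodeNo-good (path α j))) j
               (trans (sym (Δ-along α j (f-approx-long α j))) Δj)
    decode : Marked (prefix α j) j → Σ ℕ λ m′ → α (pcode (u ∷ʳ m′)) ≡ true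
    decode (inj₁ j≡0) = ⊥-elim (1+n≢0 (trans (+-comm 1 (pcode (u ∷ʳ m))) j≡0))
    decode (inj₂ (k , αk , b , j≡))
      with column-code u m k b (suc-injective (trans (+-comm 1 (pcode (u ∷ʳ m))) j≡))
    ... | m′ , code = m′ , subst (λ i → α i ≡ true) (sym code) (bit-prefix-true α {j} αk)

lemma3p4 : (G : Cantor → Set) → IsDenseGδ G →
    (E : List Bool → List Bool → Set) → IsTest E →
    Σ Cantor λ α₀ → Σ (Cantor → Cantor) λ f →
      G α₀ × (∀ α → G (f α)) × Continuous f ×
      (∀ α →
        Body E α₀ (f α) ×
        (∀ (t : List ℕ) (m : ℕ) →
          (α (pcode (t ∷ʳ m)) ≡ true →
            Σ ℕ λ m' → (α₀ Δ f α) (pcode (t ∷ʳ m') + 1) ≡ true) ×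
          ((α₀ Δ f α) (pcode (t ∷ʳ m) + 1) ≡ true →
            Σ ℕ λ m' → α (pcode (t ∷ʳ m')) ≡ true)))
lemma3p4 G (W , dense , G⇔) E test =
  α₀ , f ,
  Equivalence.from (G⇔ α₀) α₀-meets-W ,
  (λ α → Equivalence.from (G⇔ (f α)) (f-meets-W α)) ,
  f-continuous ,
  λ α → f-branch α , λ u m → bits-to-differences α u m , differences-to-bits α u m
  where open Construction W dense E test
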